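{- Let $k\geq 2$ and let $X$ be a $k$-connected multigraph. Then the complete generalized truncation $Y$ of $X$ is $k$-connected.
   Context: A multigraph may have multiple edges but no loops; it is assumed to have no isolated vertices. Generalized truncation of $X$: take a matching $M_0$ with $|M_0|=|E(X)|$ (on $2|E(X)|$ new vertices) and a bijection $F:E(X)\to M_0$; for each edge $e$ of $X$ with ends $u,v$, label one end of $F(e)$ by $u$ and the other by $v$. For $v\in V(X)$, the cluster $\mathrm{cl}(v)$ is the set of vertices labelled $v$; insert a graph $\mathrm{con}(v)$ (constituent) on $\mathrm{cl}(v)$. The result $F(M_0)\cup\bigcup_v\mathrm{con}(v)$ is a generalized truncation; it is complete if every constituent is a complete graph. A multigraph is $k$-connected if every pair of distinct vertices is joined by $k$ internally disjoint paths. -}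

module Defs where

open import Data.Nat using (ℕ; suc; _≤_; _<_)
open import Data.Nat.Properties using (<-irrefl)
open import Data.Fin using (Fin; zero; suc; toℕ; fromℕ; inject₁)
open import Data.Bool using (Bool; true; false)
open import Data.Product using (Σ; ∃; ∃-syntax; _×_; _,_; proj₁; proj₂)
open import Data.Sum using (_⊎_; inj₁; inj₂)
open import Data.Empty using (⊥)
open import Relation.Nullary using (¬_)
open import Relation.Binary.PropositionalEquality using (_≡_; _≢_; refl; cong)
open import Function.Definitions using (Injective)

-- A (loopless) multigraph: vertex type, edge type, each edge has two
-- distinct ends.  Parallel edges are allowed (distinct elements of E with
-- the same ends).
record Multigraph : Set₁ where
  field
    V        : Set
    E        : Set
    ends     : E → V × V
    loopless : ∀ e → proj₁ (ends e) ≢ proj₂ (ends e)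

open Multigraph public

Joins : (G : Multigraph) → E G → V G → V G → Set
Joins G e a b = ends G e ≡ (a , b) ⊎ ends G e ≡ (b , a)

record Path (G : Multigraph) (u v : V G) : Set where
  field
    len   : ℕ
    vs    : Fin (suc len) → V G
    es    : Fin len → E G
    start : vs zero ≡ u
    end   : vs (fromℕ len) ≡ v
    steps : ∀ i → Joins G (es i) (vs (inject₁ i)) (vs (suc i))
    simple : Injective _≡_ _≡_ vs

open Path public

Internal : {G : Multigraph} {u v : V G} → Path G u v → V G → Set
Internal {u = u} {v = v} p x = (∃[ i ] vs p i ≡ x) × x ≢ u × x ≢ v

UsesEdge : {G : Multigraph} {u v : V G} → Path G u v → E G → Set
UsesEdge p e = ∃[ i ] es p i ≡ e

-- Distinct paths are required to share no edge; for paths with no common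
-- internal vertex this is exactly distinctness (it only matters for
-- paths consisting of a single edge, i.e. parallel edges).
InternallyDisjointPaths : (G : Multigraph) → ℕ → V G → V G → Set
InternallyDisjointPaths G k u v =
  Σ (Fin k → Path G u v) λ P →
    ∀ i j → i ≢ j →
      (∀ x → Internal (P i) x → Internal (P j) x → ⊥) ×
      (∀ e → UsesEdge (P i) e → UsesEdge (P j) e → ⊥)

KConnected : ℕ → Multigraph → Set
KConnected k G = ∀ (u v : V G) → u ≢ v → InternallyDisjointPaths G k u v

FinMultigraph : (n m : ℕ) (ends : Fin m → Fin n × Fin n) →
                (∀ e → proj₁ (ends e) ≢ proj₂ (ends e)) → Multigraph
FinMultigraph n m en ll = record { V = Fin n ; E = Fin m ; ends = en ; loopless = ll }

NoIsolated : Multigraph → Set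
NoIsolated G = ∀ (x : V G) → ∃[ e ] (proj₁ (ends G e) ≡ x ⊎ proj₂ (ends G e) ≡ x)

-- M₀ has vertex set Fin m × Bool; F(e) is the edge {(e,false),(e,true)};
-- the end (e,false) is labelled proj₁ (ends e), (e,true) by proj₂ (ends e).
-- cl(x) = darts labelled x; con(x) = complete graph on cl(x), one edge per
-- unordered pair of distinct darts (ordered by the edge index; two distinct
-- darts with the same label lie on distinct edges since X is loopless).

module Truncation {n m : ℕ} (en : Fin m → Fin n × Fin n) where

  Dart : Set
  Dart = Fin m × Bool

  label : Dart → Fin n
  label (e , false) = proj₁ (en e)
  label (e , true)  = proj₂ (en e)

  ConEdge : Set
  ConEdge = Σ (Dart × Dart) λ { (d₁ , d₂) →
              (toℕ (proj₁ d₁) < toℕ (proj₁ d₂)) × (label d₁ ≡ label d₂) }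

  YEdge : Set
  YEdge = Fin m ⊎ ConEdge

  yends : YEdge → Dart × Dart
  yends (inj₁ e) = (e , false) , (e , true)
  yends (inj₂ ((d₁ , d₂) , _)) = d₁ , d₂

  yloopless : ∀ f → proj₁ (yends f) ≢ proj₂ (yends f)
  yloopless (inj₁ e) ()
  yloopless (inj₂ ((d₁ , d₂) , lt , _)) eq =
    <-irrefl (cong (λ d → toℕ (proj₁ d)) eq) lt

CompleteGeneralizedTruncation : {n m : ℕ} (en : Fin m → Fin n × Fin n) → Multigraph
CompleteGeneralizedTruncation en = record
  { V = Dart ; E = YEdge ; ends = yends ; loopless = yloopless }
  where open Truncation en

-- If x and y lie in different clusters, take k internally disjoint X-paths
-- between their labels and expand each into a Y-path: every X-edge becomes
-- its matching edge, and at every X-vertex the path crosses the cluster by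
-- one constituent edge.  Expansions of disjoint X-paths are disjoint, since
-- every interior dart of an expansion lies on an edge of its X-path.
--
-- If x and y lie in the same cluster cl(u), then u has k edge-disjoint paths
-- to a neighbour, so cl(u) contains k distinct darts d (the ends at u of their
-- first edges), and each d gives an x-y path: the constituent edge xy for
-- d = x, the path x d y for d ∉ {x, y}, and for d = y a path that leaves cl(u)
-- along the matching edges at x and y and is closed up by the expansion of an
-- X-path avoiding u (one of two internally disjoint paths between the far ends
-- avoids u).
module Submission where

open import Defs
open import Data.Nat using (ℕ; zero; suc; _≤_; s≤s)
open import Data.Nat.Properties using (<-cmp)
open import Data.Fin using (Fin; zero; suc; toℕ; fromℕ; inject₁)
open import Data.Fin.Properties using (suc-injective; toℕ-injective) renaming (_≟_ to _≟F_)
open import Data.Bool using (false; true; not)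
open import Data.Bool.Properties using () renaming (_≟_ to _≟B_)
open import Data.Product using (Σ; ∃-syntax; _×_; _,_; proj₁; proj₂)
open import Data.Product.Properties using (≡-dec)
open import Data.Sum using (_⊎_; inj₁; inj₂; [_,_]′)
open import Data.Sum.Properties using (inj₁-injective)
open import Data.Empty using (⊥; ⊥-elim)
open import Data.Unit using (⊤; tt)
open import Function using (_∘_)
open import Function.Definitions using (Injective)
open import Relation.Nullary using (¬_; Dec; yes; no)
open import Relation.Nullary.Decidable using (_⊎-dec_)
open import Relation.Binary using (tri<; tri≈; tri>)
open import Relation.Binary.Definitions using (DecidableEquality)
open import Relation.Binary.PropositionalEquality using (_≡_; _≢_; refl; sym; trans; cong; subst)

module Walks (G : Multigraph) where

  data Walk : V G → V G → Set where
    [_]  : (v : V G) → Walk v v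
    step : ∀ {u w v} (e : E G) → Joins G e u w → Walk w v → Walk u v

  Visits : ∀ {u v} → Walk u v → V G → Set
  Visits [ v ] z = v ≡ z
  Visits (step {u} e j w) z = u ≡ z ⊎ Visits w z

  Uses : ∀ {u v} → Walk u v → E G → Set
  Uses [ v ] f = ⊥
  Uses (step e j w) f = e ≡ f ⊎ Uses w f

  Simple : ∀ {u v} → Walk u v → Set
  Simple [ v ] = ⊤
  Simple (step {u} e j w) = ¬ Visits w u × Simple w

  visits? : DecidableEquality (V G) → ∀ {u v} (w : Walk u v) z → Dec (Visits w z)
  visits? _≟_ [ v ] z = v ≟ z
  visits? _≟_ (step {u} e j w) z = (u ≟ z) ⊎-dec visits? _≟_ w z

  Link : V G → V G → Set
  Link a b = Σ (E G) λ e → Joins G e a b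

  EndOf : E G → V G → Set
  EndOf f z = z ≡ proj₁ (ends G f) ⊎ z ≡ proj₂ (ends G f)

  link-endˡ : ∀ {a b} (l : Link a b) → EndOf (proj₁ l) a
  link-endˡ (_ , inj₁ eq) = inj₁ (sym (cong proj₁ eq))
  link-endˡ (_ , inj₂ eq) = inj₂ (sym (cong proj₂ eq))

  link-endʳ : ∀ {a b} (l : Link a b) → EndOf (proj₁ l) b
  link-endʳ (_ , inj₁ eq) = inj₂ (sym (cong proj₂ eq))
  link-endʳ (_ , inj₂ eq) = inj₁ (sym (cong proj₁ eq))

  link-sym : ∀ {a b} → Link a b → Link b a
  link-sym (e , inj₁ eq) = e , inj₂ eq
  link-sym (e , inj₂ eq) = e , inj₁ eq

  endOf-joins : ∀ {f a b z} → Joins G f a b → EndOf f z → z ≡ a ⊎ z ≡ b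
  endOf-joins (inj₁ eq) (inj₁ ez) = inj₁ (trans ez (cong proj₁ eq))
  endOf-joins (inj₁ eq) (inj₂ ez) = inj₂ (trans ez (cong proj₂ eq))
  endOf-joins (inj₂ eq) (inj₁ ez) = inj₂ (trans ez (cong proj₁ eq))
  endOf-joins (inj₂ eq) (inj₂ ez) = inj₁ (trans ez (cong proj₂ eq))

  visits-start : ∀ {u v} (w : Walk u v) → Visits w u
  visits-start [ v ] = refl
  visits-start (step e j w) = inj₁ refl

  visits-endOf : ∀ {u v} (w : Walk u v) {f z} → Uses w f → EndOf f z → Visits w z
  visits-endOf (step e j w) (inj₁ refl) ez with endOf-joins j ez
  ... | inj₁ refl = inj₁ refl
  ... | inj₂ refl = inj₂ (visits-start w)
  visits-endOf (step e j w) (inj₂ uw) ez = inj₂ (visits-endOf w uw ez)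

  edgeWalk : ∀ {a b} → Link a b → Walk a b
  edgeWalk {b = b} (e , j) = step e j [ b ]

  edgeWalk-simple : ∀ {a b} (l : Link a b) → a ≢ b → Simple (edgeWalk l)
  edgeWalk-simple l a≢b = (λ eq → a≢b (sym eq)) , tt

  twoEdgeWalk : ∀ {a c b} → Link a c → Link c b → Walk a b
  twoEdgeWalk (e , j) l = step e j (edgeWalk l)

  twoEdgeWalk-simple : ∀ {a c b} (l₁ : Link a c) (l₂ : Link c b) →
    a ≢ c → a ≢ b → c ≢ b → Simple (twoEdgeWalk l₁ l₂)
  twoEdgeWalk-simple l₁ l₂ a≢c a≢b c≢b =
    (λ { (inj₁ eq) → a≢c (sym eq) ; (inj₂ eq) → a≢b (sym eq) }) , edgeWalk-simple l₂ c≢b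

  twoEdgeWalk-edges : ∀ {a c b} (l₁ : Link a c) (l₂ : Link c b) →
    ∀ f → Uses (twoEdgeWalk l₁ l₂) f → EndOf f c
  twoEdgeWalk-edges l₁ l₂ f (inj₁ refl) = link-endʳ l₁
  twoEdgeWalk-edges l₁ l₂ f (inj₂ (inj₁ refl)) = link-endˡ l₂

  snoc : ∀ {u v w} → Walk u v → Link v w → Walk u w
  snoc [ v ] l = edgeWalk l
  snoc (step e j q) l = step e j (snoc q l)

  snoc-visits : ∀ {u v w} (q : Walk u v) (l : Link v w) {z} →
    Visits (snoc q l) z → Visits q z ⊎ w ≡ z
  snoc-visits [ v ] l (inj₁ eq) = inj₁ eq
  snoc-visits [ v ] l (inj₂ eq) = inj₂ eq
  snoc-visits (step e j q) l (inj₁ eq) = inj₁ (inj₁ eq)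
  snoc-visits (step e j q) l (inj₂ vz) with snoc-visits q l vz
  ... | inj₁ vz' = inj₁ (inj₂ vz')
  ... | inj₂ eq = inj₂ eq

  snoc-uses : ∀ {u v w} (q : Walk u v) (l : Link v w) {g} →
    Uses (snoc q l) g → Uses q g ⊎ proj₁ l ≡ g
  snoc-uses [ v ] l (inj₁ eq) = inj₂ eq
  snoc-uses (step e j q) l (inj₁ eq) = inj₁ (inj₁ eq)
  snoc-uses (step e j q) l (inj₂ ug) with snoc-uses q l ug
  ... | inj₁ ug' = inj₁ (inj₂ ug')
  ... | inj₂ eq = inj₂ eq

  snoc-simple : ∀ {u v w} (q : Walk u v) (l : Link v w) →
    Simple q → ¬ Visits q w → Simple (snoc q l)
  snoc-simple [ v ] l tt w∉q = edgeWalk-simple l w∉q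
  snoc-simple (step e j q) l (u∉q , sq) w∉q =
    [ u∉q , (λ eq → w∉q (inj₁ (sym eq))) ]′ ∘ snoc-visits q l ,
    snoc-simple q l sq (w∉q ∘ inj₂)

  InteriorDisjoint : ∀ {u v} → Walk u v → Walk u v → Set
  InteriorDisjoint {u} {v} q₁ q₂ = ∀ z → Visits q₁ z → Visits q₂ z → z ≢ u → z ≢ v → ⊥

  EdgeDisjoint : ∀ {u v u' v'} → Walk u v → Walk u' v' → Set
  EdgeDisjoint q₁ q₂ = ∀ f → Uses q₁ f → Uses q₂ f → ⊥

  record Disjoint {u v} (q₁ q₂ : Walk u v) : Set where
    constructor disjoint
    field
      interior : InteriorDisjoint q₁ q₂
      edges    : EdgeDisjoint q₁ q₂

  Disjoint-sym : ∀ {u v} {q₁ q₂ : Walk u v} → Disjoint q₁ q₂ → Disjoint q₂ q₁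
  Disjoint-sym (disjoint apart edge-apart) =
    disjoint (λ z v₂ v₁ → apart z v₁ v₂) (λ f u₂ u₁ → edge-apart f u₁ u₂)

  edgeDisjoint-byEnds : ∀ {u v u' v'} (q₁ : Walk u v) (q₂ : Walk u' v') →
    (∀ f → Uses q₁ f → ∃[ z ] EndOf f z × ¬ Visits q₂ z) → EdgeDisjoint q₁ q₂
  edgeDisjoint-byEnds _ q₂ far f u₁ u₂ with far f u₁
  ... | z , ez , z∉q₂ = z∉q₂ (visits-endOf q₂ u₂ ez)

  sharedEdge-endpoint : DecidableEquality (V G) → ∀ {u v} {q₁ q₂ : Walk u v} {f z} →
    InteriorDisjoint q₁ q₂ → Uses q₁ f → Uses q₂ f → EndOf f z → z ≡ u ⊎ z ≡ v
  sharedEdge-endpoint _≟_ {u} {v} {q₁} {q₂} {z = z} apart u₁ u₂ ez with z ≟ u | z ≟ v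
  ... | yes z≡u | _ = inj₁ z≡u
  ... | no _ | yes z≡v = inj₂ z≡v
  ... | no z≢u | no z≢v = ⊥-elim (apart z (visits-endOf q₁ u₁ ez) (visits-endOf q₂ u₂ ez) z≢u z≢v)

  DisjointWalks : ℕ → V G → V G → Set
  DisjointWalks k u v = Σ (Fin k → Walk u v) λ W →
    (∀ i → Simple (W i)) × (∀ i j → i ≢ j → Disjoint (W i) (W j))

  length : ∀ {u v} → Walk u v → ℕ
  length [ v ] = 0
  length (step e j w) = suc (length w)

  vertex : ∀ {u v} (w : Walk u v) → Fin (suc (length w)) → V G
  vertex [ v ] zero = v
  vertex (step {u} e j w) zero = u
  vertex (step e j w) (suc i) = vertex w i

  edge : ∀ {u v} (w : Walk u v) → Fin (length w) → E G
  edge (step e j w) zero = e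
  edge (step e j w) (suc i) = edge w i

  vertex-first : ∀ {u v} (w : Walk u v) → vertex w zero ≡ u
  vertex-first [ v ] = refl
  vertex-first (step e j w) = refl

  vertex-last : ∀ {u v} (w : Walk u v) → vertex w (fromℕ (length w)) ≡ v
  vertex-last [ v ] = refl
  vertex-last (step e j w) = vertex-last w

  edge-joins : ∀ {u v} (w : Walk u v) i →
    Joins G (edge w i) (vertex w (inject₁ i)) (vertex w (suc i))
  edge-joins (step {u} e j w) zero = subst (Joins G e u) (sym (vertex-first w)) j
  edge-joins (step e j w) (suc i) = edge-joins w i

  visits-vertex : ∀ {u v} (w : Walk u v) i → Visits w (vertex w i)
  visits-vertex [ v ] zero = refl
  visits-vertex (step e j w) zero = inj₁ refl
  visits-vertex (step e j w) (suc i) = inj₂ (visits-vertex w i)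

  uses-edge : ∀ {u v} (w : Walk u v) i → Uses w (edge w i)
  uses-edge (step e j w) zero = inj₁ refl
  uses-edge (step e j w) (suc i) = inj₂ (uses-edge w i)

  vertex-injective : ∀ {u v} (w : Walk u v) → Simple w → Injective _≡_ _≡_ (vertex w)
  vertex-injective [ v ] _ {zero} {zero} _ = refl
  vertex-injective (step e j w) _ {zero} {zero} _ = refl
  vertex-injective (step e j w) (u∉w , _) {zero} {suc i} eq =
    ⊥-elim (u∉w (subst (Visits w) (sym eq) (visits-vertex w i)))
  vertex-injective (step e j w) (u∉w , _) {suc i} {zero} eq =
    ⊥-elim (u∉w (subst (Visits w) eq (visits-vertex w i)))
  vertex-injective (step e j w) (_ , sw) {suc i} {suc i'} eq = cong suc (vertex-injective w sw eq)

  toPath : ∀ {u v} (w : Walk u v) → Simple w → Path G u v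
  toPath w sw = record
    { len = length w ; vs = vertex w ; es = edge w ; start = vertex-first w ; end = vertex-last w
    ; steps = edge-joins w ; simple = vertex-injective w sw }

  toDisjointPaths : ∀ {k u v} → DisjointWalks k u v → InternallyDisjointPaths G k u v
  toDisjointPaths (W , simple , pairwise) = (λ i → toPath (W i) (simple i)) , λ i j i≢j →
    (λ { z ((a , refl) , z≢u , z≢v) ((b , eq) , _) →
         Disjoint.interior (pairwise i j i≢j) z (visits-vertex (W i) a)
           (subst (Visits (W j)) eq (visits-vertex (W j) b)) z≢u z≢v }) ,
    (λ { f (a , refl) (b , eq) →
         Disjoint.edges (pairwise i j i≢j) f (uses-edge (W i) a)
           (subst (Uses (W j)) eq (uses-edge (W j) b)) })

  fromSequence : (l : ℕ) (vs : Fin (suc l) → V G) (es : Fin l → E G) →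
    (∀ i → Joins G (es i) (vs (inject₁ i)) (vs (suc i))) → Walk (vs zero) (vs (fromℕ l))
  fromSequence zero vs es js = [ vs zero ]
  fromSequence (suc l) vs es js =
    step (es zero) (js zero) (fromSequence l (vs ∘ suc) (es ∘ suc) (js ∘ suc))

  fromSequence-visits : ∀ l vs es js {z} → Visits (fromSequence l vs es js) z → ∃[ i ] vs i ≡ z
  fromSequence-visits zero vs es js eq = zero , eq
  fromSequence-visits (suc l) vs es js (inj₁ eq) = zero , eq
  fromSequence-visits (suc l) vs es js (inj₂ vz)
    with fromSequence-visits l (vs ∘ suc) (es ∘ suc) (js ∘ suc) vz
  ... | i , eq = suc i , eq

  fromSequence-uses : ∀ l vs es js {f} → Uses (fromSequence l vs es js) f → ∃[ i ] es i ≡ f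
  fromSequence-uses (suc l) vs es js (inj₁ eq) = zero , eq
  fromSequence-uses (suc l) vs es js (inj₂ uf)
    with fromSequence-uses l (vs ∘ suc) (es ∘ suc) (js ∘ suc) uf
  ... | i , eq = suc i , eq

  fromSequence-simple : ∀ l vs es js → Injective _≡_ _≡_ vs → Simple (fromSequence l vs es js)
  fromSequence-simple zero vs es js _ = tt
  fromSequence-simple (suc l) vs es js inj =
    (λ v₀ → first-unrepeated (fromSequence-visits l (vs ∘ suc) (es ∘ suc) (js ∘ suc) v₀)) ,
    fromSequence-simple l (vs ∘ suc) (es ∘ suc) (js ∘ suc) (suc-injective ∘ inj)
    where
      first-unrepeated : ¬ (∃[ i ] vs (suc i) ≡ vs zero)
      first-unrepeated (i , eq) with inj eq
      ... | ()

  fromPath : ∀ {u v} → Path G u v → Walk u v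
  fromPath record { len = l ; vs = vs ; es = es ; start = refl ; end = refl ; steps = js } =
    fromSequence l vs es js

  fromPath-visits : ∀ {u v} (p : Path G u v) {z} → Visits (fromPath p) z → ∃[ i ] vs p i ≡ z
  fromPath-visits record { start = refl ; end = refl } = fromSequence-visits _ _ _ _

  fromPath-uses : ∀ {u v} (p : Path G u v) {f} → Uses (fromPath p) f → UsesEdge p f
  fromPath-uses record { start = refl ; end = refl } = fromSequence-uses _ _ _ _

  fromPath-simple : ∀ {u v} (p : Path G u v) → Simple (fromPath p)
  fromPath-simple record { start = refl ; end = refl ; simple = inj } = fromSequence-simple _ _ _ _ inj

  fromDisjointPaths : ∀ {k u v} → InternallyDisjointPaths G k u v → DisjointWalks k u v
  fromDisjointPaths (P , pairwise) = fromPath ∘ P , fromPath-simple ∘ P , λ i j i≢j → disjoint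
    (λ z zi zj z≢u z≢v → proj₁ (pairwise i j i≢j) z
       (fromPath-visits (P i) zi , z≢u , z≢v) (fromPath-visits (P j) zj , z≢u , z≢v))
    (λ f fi fj → proj₂ (pairwise i j i≢j) f (fromPath-uses (P i) fi) (fromPath-uses (P j) fj))

  avoidingWalk : DecidableEquality (V G) → ∀ {k} → 2 ≤ k → KConnected k G →
    ∀ a b u → u ≢ a → u ≢ b → Σ (Walk a b) λ W → Simple W × ¬ Visits W u
  avoidingWalk _≟_ {suc (suc _)} (s≤s (s≤s _)) conn a b u u≢a u≢b with a ≟ b
  ... | yes refl = [ a ] , tt , u≢a ∘ sym
  ... | no a≢b with fromDisjointPaths (conn a b a≢b)
  ... | W , simple , pairwise with visits? _≟_ (W zero) u
  ... | no u∉W₀ = W zero , simple zero , u∉W₀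
  ... | yes u∈W₀ = W (suc zero) , simple (suc zero) ,
        λ u∈W₁ → Disjoint.interior (pairwise zero (suc zero) λ ()) u u∈W₀ u∈W₁ u≢a u≢b

  neighbour : NoIsolated G → ∀ u → ∃[ w ] u ≢ w
  neighbour noIsolated u with noIsolated u
  ... | e , inj₁ p = proj₂ (ends G e) , λ eq → loopless G e (trans p eq)
  ... | e , inj₂ p = proj₁ (ends G e) , λ eq → loopless G e (trans (sym eq) (sym p))

  firstEdge : ∀ {a b} (w : Walk a b) → a ≢ b → ∃[ e ] Uses w e × EndOf e a
  firstEdge [ a ] a≢a = ⊥-elim (a≢a refl)
  firstEdge (step e j w) _ = e , inj₁ refl , link-endˡ (e , j)

  incidentEdges : ∀ {k} → NoIsolated G → KConnected k G → ∀ u →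
    Σ (Fin k → E G) λ f → Injective _≡_ _≡_ f × (∀ i → EndOf (f i) u)
  incidentEdges noIsolated conn u with neighbour noIsolated u
  ... | w , u≢w with fromDisjointPaths (conn u w u≢w)
  ... | W , _ , pairwise = proj₁ ∘ first , injective , proj₂ ∘ proj₂ ∘ first
    where
      first : ∀ i → ∃[ e ] Uses (W i) e × EndOf e u
      first i = firstEdge (W i) u≢w
      injective : Injective _≡_ _≡_ (proj₁ ∘ first)
      injective {i} {j} eq with i ≟F j
      ... | yes i≡j = i≡j
      ... | no i≢j = ⊥-elim (Disjoint.edges (pairwise i j i≢j) _ (proj₁ (proj₂ (first i)))
                       (subst (Uses (W j)) (sym eq) (proj₁ (proj₂ (first j)))))

module CompleteTruncation {n m : ℕ} (en : Fin m → Fin n × Fin n)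
                          (noLoops : ∀ e → proj₁ (en e) ≢ proj₂ (en e)) where

  open Truncation en

  X : Multigraph
  X = FinMultigraph n m en noLoops

  Y : Multigraph
  Y = CompleteGeneralizedTruncation en

  module WX = Walks X
  module WY = Walks Y

  _≟D_ : DecidableEquality Dart
  _≟D_ = ≡-dec _≟F_ _≟B_

  dart-≡ : ∀ {d₁ d₂ : Dart} → proj₁ d₁ ≡ proj₁ d₂ → label d₁ ≡ label d₂ → d₁ ≡ d₂
  dart-≡ {e , false} {.e , false} refl _ = refl
  dart-≡ {e , false} {.e , true} refl l = ⊥-elim (noLoops e l)
  dart-≡ {e , true} {.e , false} refl l = ⊥-elim (noLoops e (sym l))
  dart-≡ {e , true} {.e , true} refl _ = refl

  clusterEdge : ∀ {d₁ d₂} → label d₁ ≡ label d₂ → d₁ ≢ d₂ → ConEdge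
  clusterEdge {d₁} {d₂} l d₁≢d₂ with <-cmp (toℕ (proj₁ d₁)) (toℕ (proj₁ d₂))
  ... | tri< lt _ _ = (d₁ , d₂) , lt , l
  ... | tri≈ _ eq _ = ⊥-elim (d₁≢d₂ (dart-≡ (toℕ-injective eq) l))
  ... | tri> _ _ gt = (d₂ , d₁) , gt , sym l

  clusterEdge-joins : ∀ {d₁ d₂} (l : label d₁ ≡ label d₂) (d₁≢d₂ : d₁ ≢ d₂) →
    Joins Y (inj₂ (clusterEdge l d₁≢d₂)) d₁ d₂
  clusterEdge-joins {d₁} {d₂} l d₁≢d₂ with <-cmp (toℕ (proj₁ d₁)) (toℕ (proj₁ d₂))
  ... | tri< _ _ _ = inj₁ refl
  ... | tri≈ _ eq _ = ⊥-elim (d₁≢d₂ (dart-≡ (toℕ-injective eq) l))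
  ... | tri> _ _ _ = inj₂ refl

  clusterLink : ∀ {d₁ d₂} → label d₁ ≡ label d₂ → d₁ ≢ d₂ → WY.Link d₁ d₂
  clusterLink l d₁≢d₂ = inj₂ (clusterEdge l d₁≢d₂) , clusterEdge-joins l d₁≢d₂

  clusterEdge-notBetween : ∀ {x y} → label x ≢ label y → (c : ConEdge) →
    ¬ (∀ z → WY.EndOf (inj₂ c) z → z ≡ x ⊎ z ≡ y)
  clusterEdge-notBetween {x} {y} lx≢ly c@((d₁ , d₂) , _ , l) between =
    impossible (between d₁ (inj₁ refl)) (between d₂ (inj₂ refl))
    where
      impossible : d₁ ≡ x ⊎ d₁ ≡ y → d₂ ≡ x ⊎ d₂ ≡ y → ⊥
      impossible (inj₁ p) (inj₁ q) = loopless Y (inj₂ c) (trans p (sym q))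
      impossible (inj₁ p) (inj₂ q) = lx≢ly (trans (cong label (sym p)) (trans l (cong label q)))
      impossible (inj₂ p) (inj₁ q) = lx≢ly (trans (cong label (sym q)) (trans (sym l) (cong label p)))
      impossible (inj₂ p) (inj₂ q) = loopless Y (inj₂ c) (trans p (sym q))

  dartAt : ∀ {e u} → WX.EndOf e u → Dart
  dartAt {e} (inj₁ _) = e , false
  dartAt {e} (inj₂ _) = e , true

  label-dartAt : ∀ {e u} (p : WX.EndOf e u) → label (dartAt p) ≡ u
  label-dartAt (inj₁ eq) = sym eq
  label-dartAt (inj₂ eq) = sym eq

  edge-dartAt : ∀ {e u} (p : WX.EndOf e u) → proj₁ (dartAt p) ≡ e
  edge-dartAt (inj₁ _) = refl
  edge-dartAt (inj₂ _) = refl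

  nearDart farDart : ∀ {e a b} → Joins X e a b → Dart
  nearDart {e} j = dartAt (WX.link-endˡ (e , j))
  farDart {e} j = dartAt (WX.link-endʳ (e , j))

  label-nearDart : ∀ {e a b} (j : Joins X e a b) → label (nearDart j) ≡ a
  label-nearDart {e} j = label-dartAt (WX.link-endˡ (e , j))

  label-farDart : ∀ {e a b} (j : Joins X e a b) → label (farDart j) ≡ b
  label-farDart {e} j = label-dartAt (WX.link-endʳ (e , j))

  edge-nearDart : ∀ {e a b} (j : Joins X e a b) → proj₁ (nearDart j) ≡ e
  edge-nearDart {e} j = edge-dartAt (WX.link-endˡ (e , j))

  edge-farDart : ∀ {e a b} (j : Joins X e a b) → proj₁ (farDart j) ≡ e
  edge-farDart {e} j = edge-dartAt (WX.link-endʳ (e , j))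

  matching : ∀ {e a b} (j : Joins X e a b) → Joins Y (inj₁ e) (nearDart j) (farDart j)
  matching (inj₁ _) = inj₁ refl
  matching (inj₂ _) = inj₂ refl

  partner : Dart → Dart
  partner (e , b) = e , not b

  label-partner : ∀ d → label (partner d) ≢ label d
  label-partner (e , false) eq = noLoops e (sym eq)
  label-partner (e , true) eq = noLoops e eq

  partner-matching : ∀ d → Joins Y (inj₁ (proj₁ d)) d (partner d)
  partner-matching (e , false) = inj₁ refl
  partner-matching (e , true) = inj₂ refl

  partnerLink : ∀ d → WY.Link d (partner d)
  partnerLink d = inj₁ (proj₁ d) , partner-matching d

  IsPrefixedBy : ∀ {s t} (x : Dart) → WY.Walk s t → WY.Walk x t → Set
  IsPrefixedBy {s} x q q' =
    (∀ d → WY.Visits q' d → x ≡ d ⊎ WY.Visits q d) ×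
    (∀ e → WY.Uses q' (inj₁ e) → WY.Uses q (inj₁ e)) ×
    (WY.Simple q → (∀ d → WY.Visits q d → label d ≡ label x → d ≡ s) → WY.Simple q')

  prependInCluster : ∀ {s t} (x : Dart) (q : WY.Walk s t) → label x ≡ label s →
    Σ (WY.Walk x t) (IsPrefixedBy x q)
  prependInCluster {s} x q l with x ≟D s
  ... | yes refl = q , (λ _ → inj₂) , (λ _ u → u) , (λ sq _ → sq)
  ... | no x≢s = WY.step (inj₂ (clusterEdge l x≢s)) (clusterEdge-joins l x≢s) q ,
        (λ _ v → v) , (λ { _ (inj₁ ()) ; _ (inj₂ u) → u }) ,
        (λ sq only-s → (λ v → x≢s (only-s x v refl)) , sq)

  IsExpansionOf : ∀ {a b x y} → WX.Walk a b → WY.Walk x y → Set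
  IsExpansionOf {x = x} {y} W q =
    WY.Simple q ×
    (∀ d → WY.Visits q d → WX.Visits W (label d)) ×
    (∀ d → WY.Visits q d → d ≡ x ⊎ d ≡ y ⊎ WX.Uses W (proj₁ d)) ×
    (∀ e → WY.Uses q (inj₁ e) → WX.Uses W e)

  expand : ∀ {a b} (W : WX.Walk a b) → WX.Simple W → (x y : Dart) → label x ≡ a → label y ≡ b →
    Σ (WY.Walk x y) (IsExpansionOf W)
  expand WX.[ a ] _ x y lx ly with prependInCluster x WY.[ y ] (trans lx (sym ly))
  ... | q , visits , uses , simple =
    q , simple tt (λ d eq _ → sym eq) , (λ d → labels ∘ visits d) , (λ d → darts ∘ visits d) , uses
    where
      labels : ∀ {d} → x ≡ d ⊎ y ≡ d → a ≡ label d
      labels (inj₁ eq) = trans (sym lx) (cong label eq)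
      labels (inj₂ eq) = trans (sym ly) (cong label eq)
      darts : ∀ {d} → x ≡ d ⊎ y ≡ d → d ≡ x ⊎ d ≡ y ⊎ ⊥
      darts (inj₁ eq) = inj₁ (sym eq)
      darts (inj₂ eq) = inj₂ (inj₁ (sym eq))
  expand (WX.step e j w) (a∉w , sw) x y lx ly
    with expand w sw (farDart j) y (label-farDart j) ly
  ... | q' , sq' , labels' , darts' , matching' =
    proj₁ pre , proj₂ (proj₂ (proj₂ pre)) r-simple onlyNear , labels , darts , uses
    where
      r : WY.Walk (nearDart j) y
      r = WY.step (inj₁ e) (matching j) q'

      pre : Σ (WY.Walk x y) (IsPrefixedBy x r)
      pre = prependInCluster x r (trans lx (sym (label-nearDart j)))

      r-simple : WY.Simple r
      r-simple = (λ v → a∉w (subst (WX.Visits w) (label-nearDart j) (labels' _ v))) , sq'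

      onlyNear : ∀ d → WY.Visits r d → label d ≡ label x → d ≡ nearDart j
      onlyNear d (inj₁ eq) _ = sym eq
      onlyNear d (inj₂ v) l = ⊥-elim (a∉w (subst (WX.Visits w) (trans l lx) (labels' d v)))

      labels : ∀ d → WY.Visits (proj₁ pre) d → WX.Visits (WX.step e j w) (label d)
      labels d v with proj₁ (proj₂ pre) d v
      ... | inj₁ eq = inj₁ (trans (sym lx) (cong label eq))
      ... | inj₂ (inj₁ eq) = inj₁ (trans (sym (label-nearDart j)) (cong label eq))
      ... | inj₂ (inj₂ v') = inj₂ (labels' d v')

      darts : ∀ d → WY.Visits (proj₁ pre) d → d ≡ x ⊎ d ≡ y ⊎ WX.Uses (WX.step e j w) (proj₁ d)
      darts d v with proj₁ (proj₂ pre) d v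
      ... | inj₁ eq = inj₁ (sym eq)
      ... | inj₂ (inj₁ eq) = inj₂ (inj₂ (inj₁ (trans (sym (edge-nearDart j)) (cong proj₁ eq))))
      ... | inj₂ (inj₂ v') with darts' d v'
      ...   | inj₁ eq = inj₂ (inj₂ (inj₁ (trans (sym (edge-farDart j)) (cong proj₁ (sym eq)))))
      ...   | inj₂ (inj₁ eq) = inj₂ (inj₁ eq)
      ...   | inj₂ (inj₂ u) = inj₂ (inj₂ (inj₂ u))

      uses : ∀ e' → WY.Uses (proj₁ pre) (inj₁ e') → WX.Uses (WX.step e j w) e'
      uses e' u with proj₁ (proj₂ (proj₂ pre)) e' u
      ... | inj₁ eq = inj₁ (inj₁-injective eq)
      ... | inj₂ u' = inj₂ (matching' e' u')

  expansions-disjoint : ∀ {a b x y} {W₁ W₂ : WX.Walk a b} {q₁ q₂ : WY.Walk x y} →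
    label x ≢ label y → WX.Disjoint W₁ W₂ → IsExpansionOf W₁ q₁ → IsExpansionOf W₂ q₂ →
    WY.Disjoint q₁ q₂
  expansions-disjoint {a} {b} {x} {y} {q₁ = q₁} {q₂} lx≢ly (WX.disjoint _ W-edgeDisjoint)
    (_ , _ , darts₁ , matching₁) (_ , _ , darts₂ , matching₂) = WY.disjoint interior edges
    where
      interiorEdge : ∀ {W : WX.Walk a b} {z} → z ≢ x → z ≢ y →
        z ≡ x ⊎ z ≡ y ⊎ WX.Uses W (proj₁ z) → WX.Uses W (proj₁ z)
      interiorEdge z≢x _ (inj₁ eq) = ⊥-elim (z≢x eq)
      interiorEdge _ z≢y (inj₂ (inj₁ eq)) = ⊥-elim (z≢y eq)
      interiorEdge _ _ (inj₂ (inj₂ u)) = u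

      interior : WY.InteriorDisjoint q₁ q₂
      interior z v₁ v₂ z≢x z≢y = W-edgeDisjoint (proj₁ z)
        (interiorEdge z≢x z≢y (darts₁ z v₁)) (interiorEdge z≢x z≢y (darts₂ z v₂))

      edges : WY.EdgeDisjoint q₁ q₂
      edges (inj₁ e) u₁ u₂ = W-edgeDisjoint e (matching₁ e u₁) (matching₂ e u₂)
      edges (inj₂ c) u₁ u₂ =
        clusterEdge-notBetween lx≢ly c (λ z → WY.sharedEdge-endpoint _≟D_ interior u₁ u₂)

  differentClusterWalks : ∀ {k} → KConnected k X → ∀ {x y} → label x ≢ label y →
    WY.DisjointWalks k x y
  differentClusterWalks conn {x} {y} lx≢ly
    with WX.fromDisjointPaths (conn (label x) (label y) lx≢ly)
  ... | W , simple , pairwise =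
    (λ i → proj₁ (Q i)) , (λ i → proj₁ (proj₂ (Q i))) ,
    λ i j i≢j → expansions-disjoint lx≢ly (pairwise i j i≢j) (proj₂ (Q i)) (proj₂ (Q j))
    where
      Q : ∀ i → Σ (WY.Walk x y) (IsExpansionOf (W i))
      Q i = expand (W i) (simple i) x y refl refl

  IsOuter : ∀ {x y} → WY.Walk x y → Set
  IsOuter {x} {y} O =
    WY.Simple O ×
    (∀ z → WY.Visits O z → z ≡ x ⊎ z ≡ y ⊎ label z ≢ label x) ×
    (∀ f → WY.Uses O f → ∃[ z ] WY.EndOf f z × label z ≢ label x)

  outerWalk : ∀ {k} → 2 ≤ k → KConnected k X → ∀ {x y} → x ≢ y → label x ≡ label y →
    Σ (WY.Walk x y) IsOuter
  outerWalk k≥2 conn {x} {y} x≢y lxy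
    with WX.avoidingWalk _≟F_ k≥2 conn (label (partner x)) (label (partner y)) (label x)
           (label-partner x ∘ sym) (λ eq → label-partner y (trans (sym eq) lxy))
  ... | W , W-simple , u∉W with expand W W-simple (partner x) (partner y) refl refl
  ... | E , E-simple , E-labels , _ =
    O , (x∉snocE ∘ WY.snoc-visits E leave-y , WY.snoc-simple E leave-y E-simple y∉E) , visits , uses
    where
      E-outside : ∀ d → WY.Visits E d → label d ≢ label x
      E-outside d v eq = u∉W (subst (WX.Visits W) eq (E-labels d v))

      leave-y : WY.Link (partner y) y
      leave-y = WY.link-sym (partnerLink y)

      O : WY.Walk x y
      O = WY.step (inj₁ (proj₁ x)) (partner-matching x) (WY.snoc E leave-y)

      x∉snocE : ¬ (WY.Visits E x ⊎ y ≡ x)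
      x∉snocE (inj₁ v) = E-outside x v refl
      x∉snocE (inj₂ eq) = x≢y (sym eq)

      y∉E : ¬ WY.Visits E y
      y∉E v = E-outside y v (sym lxy)

      visits : ∀ z → WY.Visits O z → z ≡ x ⊎ z ≡ y ⊎ label z ≢ label x
      visits z (inj₁ eq) = inj₁ (sym eq)
      visits z (inj₂ v) with WY.snoc-visits E leave-y v
      ... | inj₁ v' = inj₂ (inj₂ (E-outside z v'))
      ... | inj₂ eq = inj₂ (inj₁ (sym eq))

      uses : ∀ f → WY.Uses O f → ∃[ z ] WY.EndOf f z × label z ≢ label x
      uses f (inj₁ refl) = partner x , WY.link-endʳ (partnerLink x) , label-partner x
      uses f (inj₂ u) with WY.snoc-uses E leave-y u
      ... | inj₁ u' = proj₁ (ends Y f) , inj₁ refl , E-outside _ (WY.visits-endOf E u' (inj₁ refl))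
      ... | inj₂ refl = partner y , WY.link-endˡ leave-y , λ eq → label-partner y (trans eq lxy)

  module Routes {x y : Dart} (x≢y : x ≢ y) (lxy : label x ≡ label y)
                (O : WY.Walk x y) (O-outer : IsOuter O) where

    InCluster : WY.Walk x y → Set
    InCluster q = ∀ z → WY.Visits q z → label z ≡ label x

    direct : WY.Walk x y
    direct = WY.edgeWalk (clusterLink lxy x≢y)

    direct-inCluster : InCluster direct
    direct-inCluster z (inj₁ refl) = refl
    direct-inCluster z (inj₂ refl) = sym lxy

    module _ {d : Dart} (ld : label d ≡ label x) (d≢x : d ≢ x) (d≢y : d ≢ y) where

      x-d : WY.Link x d
      x-d = clusterLink (sym ld) (d≢x ∘ sym)
      d-y : WY.Link d y
      d-y = clusterLink (trans ld lxy) d≢y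

      through : WY.Walk x y
      through = WY.twoEdgeWalk x-d d-y

      through-simple : WY.Simple through
      through-simple = WY.twoEdgeWalk-simple x-d d-y (d≢x ∘ sym) x≢y d≢y

      through-inCluster : InCluster through
      through-inCluster z (inj₁ refl) = refl
      through-inCluster z (inj₂ (inj₁ refl)) = ld
      through-inCluster z (inj₂ (inj₂ refl)) = sym lxy

      through-disjoint : ∀ q → ¬ WY.Visits q d → WY.Disjoint through q
      through-disjoint q d∉q = WY.disjoint interior
        (WY.edgeDisjoint-byEnds through q λ f u → d , WY.twoEdgeWalk-edges x-d d-y f u , d∉q)
        where
          interior : WY.InteriorDisjoint through q
          interior z (inj₁ eq) _ z≢x _ = z≢x (sym eq)
          interior z (inj₂ (inj₁ refl)) v _ _ = d∉q v
          interior z (inj₂ (inj₂ eq)) _ _ z≢y = z≢y (sym eq)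

    outer-disjoint : ∀ q → InCluster q → WY.Disjoint O q
    outer-disjoint q inCluster = WY.disjoint
      (λ z vO vq z≢x z≢y → outside z vO z≢x z≢y (inCluster z vq))
      (WY.edgeDisjoint-byEnds O q far)
      where
        outside : ∀ z → WY.Visits O z → z ≢ x → z ≢ y → label z ≢ label x
        outside z v z≢x z≢y with proj₁ (proj₂ O-outer) z v
        ... | inj₁ eq = ⊥-elim (z≢x eq)
        ... | inj₂ (inj₁ eq) = ⊥-elim (z≢y eq)
        ... | inj₂ (inj₂ l) = l
        far : ∀ f → WY.Uses O f → ∃[ z ] WY.EndOf f z × ¬ WY.Visits q z
        far f u with proj₂ (proj₂ O-outer) f u
        ... | z , ez , lz = z , ez , λ v → lz (inCluster z v)

    data Position (d : Dart) : Set where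
      atX : d ≡ x → Position d
      atY : d ≡ y → Position d
      elsewhere : d ≢ x → d ≢ y → Position d

    position : ∀ d → Position d
    position d with d ≟D x | d ≟D y
    ... | yes d≡x | _ = atX d≡x
    ... | no _ | yes d≡y = atY d≡y
    ... | no d≢x | no d≢y = elsewhere d≢x d≢y

    route : ∀ {d} → label d ≡ label x → Position d → WY.Walk x y
    route _ (atX _) = direct
    route _ (atY _) = O
    route ld (elsewhere d≢x d≢y) = through ld d≢x d≢y

    route-simple : ∀ {d} (ld : label d ≡ label x) (p : Position d) → WY.Simple (route ld p)
    route-simple _ (atX _) = WY.edgeWalk-simple (clusterLink lxy x≢y) x≢y
    route-simple _ (atY _) = proj₁ O-outer
    route-simple ld (elsewhere d≢x d≢y) = through-simple ld d≢x d≢y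

    routes-disjoint : ∀ {d d'} (ld : label d ≡ label x) (ld' : label d' ≡ label x)
      (p : Position d) (p' : Position d') → d ≢ d' → WY.Disjoint (route ld p) (route ld' p')
    routes-disjoint _ _ (atX p) (atX p') d≢d' = ⊥-elim (d≢d' (trans p (sym p')))
    routes-disjoint _ _ (atX _) (atY _) _ = WY.Disjoint-sym (outer-disjoint direct direct-inCluster)
    routes-disjoint _ ld' (atX _) (elsewhere d'≢x d'≢y) _ =
      WY.Disjoint-sym (through-disjoint ld' d'≢x d'≢y direct [ d'≢x ∘ sym , d'≢y ∘ sym ]′)
    routes-disjoint _ _ (atY _) (atX _) _ = outer-disjoint direct direct-inCluster
    routes-disjoint _ _ (atY p) (atY p') d≢d' = ⊥-elim (d≢d' (trans p (sym p')))
    routes-disjoint _ ld' (atY _) (elsewhere d'≢x d'≢y) _ =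
      outer-disjoint (through ld' d'≢x d'≢y) (through-inCluster ld' d'≢x d'≢y)
    routes-disjoint ld _ (elsewhere d≢x d≢y) (atX _) _ =
      through-disjoint ld d≢x d≢y direct [ d≢x ∘ sym , d≢y ∘ sym ]′
    routes-disjoint ld _ (elsewhere d≢x d≢y) (atY _) _ =
      WY.Disjoint-sym (outer-disjoint (through ld d≢x d≢y) (through-inCluster ld d≢x d≢y))
    routes-disjoint ld ld' (elsewhere d≢x d≢y) (elsewhere d'≢x d'≢y) d≢d' =
      through-disjoint ld d≢x d≢y (through ld' d'≢x d'≢y) [ d≢x ∘ sym , [ d≢d' ∘ sym , d≢y ∘ sym ]′ ]′

  sameClusterWalks : ∀ {k} → 2 ≤ k → NoIsolated X → KConnected k X →
    ∀ {x y} → x ≢ y → label x ≡ label y → WY.DisjointWalks k x y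
  sameClusterWalks {k} k≥2 noIsolated conn {x} {y} x≢y lxy
    with outerWalk k≥2 conn x≢y lxy | WX.incidentEdges noIsolated conn (label x)
  ... | O , O-outer | f , f-injective , f-incident =
    (λ i → route (dart-label i) (position (dart i))) ,
    (λ i → route-simple (dart-label i) (position (dart i))) ,
    λ i j i≢j → routes-disjoint (dart-label i) (dart-label j) (position (dart i)) (position (dart j))
                  (λ eq → i≢j (f-injective (trans (sym (edge-dartAt (f-incident i)))
                                           (trans (cong proj₁ eq) (edge-dartAt (f-incident j))))))
    where
      open Routes x≢y lxy O O-outer

      dart : Fin k → Dart
      dart i = dartAt (f-incident i)

      dart-label : ∀ i → label (dart i) ≡ label x
      dart-label i = label-dartAt (f-incident i)

  truncation-kConnected : ∀ {k} → 2 ≤ k → NoIsolated X → KConnected k X → KConnected k Y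
  truncation-kConnected k≥2 noIsolated conn x y x≢y with label x ≟F label y
  ... | yes lxy = WY.toDisjointPaths (sameClusterWalks k≥2 noIsolated conn x≢y lxy)
  ... | no lx≢ly = WY.toDisjointPaths (differentClusterWalks conn lx≢ly)

theorem3p8 : (k n m : ℕ) (ends : Fin m → Fin n × Fin n)
    (loopless : ∀ e → proj₁ (ends e) ≢ proj₂ (ends e)) →
    2 ≤ k →
    NoIsolated (FinMultigraph n m ends loopless) →
    KConnected k (FinMultigraph n m ends loopless) →
    KConnected k (CompleteGeneralizedTruncation ends)
theorem3p8 k n m ends loopless = CompleteTruncation.truncation-kConnected ends loopless
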